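{- Let $n\ge1$ and let $\mathcal{P}_n$ be the trivial unit interval positroid of rank $n$ on $[2n]$, with set of bases $\mathcal{B}$. Then every basis $B\in\mathcal{B}$ is either (1) $B=\{1,\dots,n\}$, or (2) $B=(\{1,\dots,n\}\setminus\{i\})\cup\{j\}$ for some $i\in\{1,\dots,n\}$ and some $j\in\{n+1,\dots,2n\}$. Moreover, $|\mathcal{B}|=n^2+1$.
   Context: The trivial unit interval positroid $\mathcal{P}_n$ is the matroid on $[2n]=\{1,\dots,2n\}$ whose bases are the index sets of maximal linearly independent sets of columns of the real $n\times 2n$ matrix whose first $n$ columns form the identity matrix $I_n$ and each of whose columns $n+1,\dots,2n$ equals the vector with entry $(-1)^{n-i}$ in row $i$.
   Formalization: Linear independence of the columns, and hence the bases of $\mathcal{P}_n$, is taken over ℚ rather than over the real numbers. -}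

module Defs where

open import Data.Nat using (ℕ; zero; suc; _∸_)
open import Data.Fin using (Fin; zero; suc; toℕ; splitAt; _↑ˡ_; _↑ʳ_)
open import Data.Fin.Subset using (Subset; _∈_; _∉_; _⊆_; ⊤; ⊥)
open import Data.Vec using (_++_)
open import Data.Sum using (inj₁; inj₂)
open import Data.Rational using (ℚ; 0ℚ; 1ℚ; -_; _*_; _+_)
open import Relation.Binary.PropositionalEquality using (_≡_)
open import Relation.Nullary using (yes; no)
import Data.Fin as F

sumFin : (m : ℕ) → (Fin m → ℚ) → ℚ
sumFin zero    f = 0ℚ
sumFin (suc m) f = f zero + sumFin m (λ k → f (suc k))

neg1^ : ℕ → ℚ
neg1^ zero    = 1ℚ
neg1^ (suc e) = - neg1^ e

-- The n × 2n matrix [ I_n | v ... v ] with v_i = (-1)^(n-i) (rows 1-indexed).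
-- Row i : Fin n is row (toℕ i + 1); columns Fin (n + n), column c ↑ˡ n is column c+1,
-- column n ↑ʳ c is column n+c+1.
entry : (n : ℕ) → Fin n → Fin (n Data.Nat.+ n) → ℚ
entry n i j with splitAt n j
... | inj₁ k with i F.≟ k
...   | yes _ = 1ℚ
...   | no  _ = 0ℚ
entry n i j | inj₂ _ = neg1^ (n ∸ suc (toℕ i))

LinIndep : (n : ℕ) → Subset (n Data.Nat.+ n) → Set
LinIndep n S =
  (λc : Fin (n Data.Nat.+ n) → ℚ) →
  (∀ j → j ∉ S → λc j ≡ 0ℚ) →
  (∀ i → sumFin (n Data.Nat.+ n) (λ j → λc j * entry n i j) ≡ 0ℚ) →
  ∀ j → λc j ≡ 0ℚ

IsBasis : (n : ℕ) → Subset (n Data.Nat.+ n) → Set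
IsBasis n B = Data.Product._×_ (LinIndep n B) (∀ T → B ⊆ T → LinIndep n T → T ≡ B)
  where import Data.Product

firstHalf : (n : ℕ) → Subset (n Data.Nat.+ n)
firstHalf n = ⊤ {n} ++ ⊥ {n}

-- Column left i of the matrix is e_i and every column right j equals v. A coefficient
-- vector λ is in the kernel exactly when λ(left i) = -(Σ_k λ(right k)) v_i for all i.
-- Hence a set S of columns is independent iff it contains at most one right j and, if it
-- does, misses some left i: the row of a missing left i forces Σ_k λ(right k) = 0 because
-- v_i = ±1, and otherwise a kernel vector supported in S is easy to write down. The
-- maximal such sets are the first half and the n² exchanges (first half - left i) ∪ {right j}.
module Submission where

open import Defs
open import Data.Nat using (ℕ; _≤_; _+_; _*_; suc; zero; _∸_)
open import Data.Nat.Properties as ℕ using ()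
open import Data.Fin using (Fin; _↑ˡ_; _↑ʳ_; zero; suc; splitAt; toℕ)
open import Data.Fin.Properties using (splitAt-↑ˡ; splitAt-↑ʳ; join-splitAt; ↑ˡ-injective; ↑ʳ-injective; suc-injective; any?; ¬∀⟶∃¬) renaming (_≟_ to _≟ᶠ_)
open import Data.Fin.Subset using (Subset; _-_; _∪_; ⁅_⁆; _─_; ⊤; ⊥; inside; outside; _∈_; _∉_; _⊆_)
open import Data.Fin.Subset.Properties using (_∈?_; x∈⁅x⁆; x∈⁅y⁆⇒x≡y; ⊆-antisym; x∈p∪q⁻; x∈p∪q⁺; x∈p∧x≢y⇒x∈p-y; p─q⊆p)
open import Data.Vec using (_∷_; here; there)
open import Data.Vec.Properties using ([]=⇒lookup; lookup⇒[]=; lookup-++ˡ; lookup-++ʳ; lookup-replicate)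
import Data.Vec.Functional as Vector
open import Data.Vec.Functional.Properties using () renaming (lookup-++ˡ to ++-↑ˡ; lookup-++ʳ to ++-↑ʳ)
open import Data.List using (List; length; cartesianProductWith; allFin; map; []) renaming (_∷_ to _∷ˡ_)
open import Data.List.Properties using (length-++; length-map; length-tabulate)
open import Data.List.Membership.Propositional using () renaming (_∈_ to _∈ˡ_)
open import Data.List.Membership.Propositional.Properties using (∈-cartesianProductWith⁺; ∈-cartesianProductWith⁻; ∈-allFin)
open import Data.List.Relation.Unary.Unique.Propositional using (Unique)
open import Data.List.Relation.Unary.Unique.Propositional.Properties using (cartesianProductWith⁺; allFin⁺)
open import Data.List.Relation.Unary.Any using (here; there)
open import Data.List.Relation.Unary.All.Properties.Core using (¬Any⇒All¬)
open import Data.List.Relation.Unary.AllPairs using (_∷_)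
open import Data.Product using (_×_; ∃; ∃-syntax; _,_)
open import Data.Sum using (_⊎_; inj₁; inj₂)
open import Data.Empty using (⊥-elim)
open import Data.Rational using (ℚ; 0ℚ; 1ℚ; -_) renaming (_+_ to _+ℚ_; _*_ to _*ℚ_)
open import Data.Rational.Properties using (+-identityˡ; +-identityʳ; *-zeroˡ; *-assoc; +-inverseˡ; 1≢0)
open import Data.Rational.Solver using (module +-*-Solver)
open import Function.Bundles using (_⇔_; mk⇔)
open import Relation.Binary.PropositionalEquality using (_≡_; _≢_; refl; sym; trans; cong; cong₂; subst; module ≡-Reasoning)
open import Relation.Nullary using (yes; no; ¬_)

open +-*-Solver using (solve; _:+_; _:*_; :-_; _:=_; con)

↑-elim : ∀ {m k} (P : Fin (m + k) → Set) →
         (∀ i → P (i ↑ˡ k)) → (∀ j → P (m ↑ʳ j)) → ∀ x → P x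
↑-elim {m} {k} P left right x with splitAt m x | join-splitAt m k x
... | inj₁ i | refl = left i
... | inj₂ j | refl = right j

↑ˡ≢↑ʳ : ∀ {m k} (i : Fin m) (j : Fin k) → i ↑ˡ k ≢ m ↑ʳ j
↑ˡ≢↑ʳ zero    j ()
↑ˡ≢↑ʳ (suc i) j eq = ↑ˡ≢↑ʳ i j (suc-injective eq)

⊆-↑ : ∀ {m k} {p q : Subset (m + k)} →
      (∀ i → i ↑ˡ k ∈ p → i ↑ˡ k ∈ q) → (∀ j → m ↑ʳ j ∈ p → m ↑ʳ j ∈ q) → p ⊆ q
⊆-↑ {p = p} {q} left right {x} = ↑-elim (λ x → x ∈ p → x ∈ q) left right x

x∈p─q⇒x∉q : ∀ {m} {p q : Subset m} {x} → x ∈ p ─ q → x ∉ q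
x∈p─q⇒x∉q {p = _ ∷ _} {inside ∷ _}  {zero}  ()
x∈p─q⇒x∉q {p = _ ∷ _} {outside ∷ _} {zero}  _ ()
x∈p─q⇒x∉q {p = _ ∷ _} {_ ∷ _}       {suc x} (there x∈p─q) (there x∈q) = x∈p─q⇒x∉q x∈p─q x∈q

x∉p-x : ∀ {m} {p : Subset m} {x} → x ∉ p - x
x∉p-x {x = x} x∈p-x = x∈p─q⇒x∉q x∈p-x (x∈⁅x⁆ x)

sumFin-cong : ∀ m {f g : Fin m → ℚ} → (∀ i → f i ≡ g i) → sumFin m f ≡ sumFin m g
sumFin-cong zero    f≗g = refl
sumFin-cong (suc m) f≗g = cong₂ _+ℚ_ (f≗g zero) (sumFin-cong m (λ i → f≗g (suc i)))

sumFin-zero : ∀ m {f : Fin m → ℚ} → (∀ i → f i ≡ 0ℚ) → sumFin m f ≡ 0ℚ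
sumFin-zero zero    f≗0 = refl
sumFin-zero (suc m) f≗0 = cong₂ _+ℚ_ (f≗0 zero) (sumFin-zero m (λ i → f≗0 (suc i)))

sumFin-single : ∀ m {f : Fin m → ℚ} i → (∀ k → k ≢ i → f k ≡ 0ℚ) → sumFin m f ≡ f i
sumFin-single (suc m) {f} zero    f≗0 =
  trans (cong (f zero +ℚ_) (sumFin-zero m (λ k → f≗0 (suc k) (λ ())))) (+-identityʳ (f zero))
sumFin-single (suc m) {f} (suc i) f≗0 =
  trans (cong (_+ℚ sumFin m (λ k → f (suc k))) (f≗0 zero (λ ())))
        (trans (+-identityˡ _) (sumFin-single m i (λ k k≢i → f≗0 (suc k) (λ eq → k≢i (suc-injective eq)))))

sumFin-+ : ∀ m (f g : Fin m → ℚ) → sumFin m (λ k → f k +ℚ g k) ≡ sumFin m f +ℚ sumFin m g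
sumFin-+ zero    f g = refl
sumFin-+ (suc m) f g =
  trans (cong (f zero +ℚ g zero +ℚ_) (sumFin-+ m (λ k → f (suc k)) (λ k → g (suc k))))
        (solve 4 (λ a b c d → (a :+ b) :+ (c :+ d) := (a :+ c) :+ (b :+ d)) refl
               (f zero) (g zero) (sumFin m (λ k → f (suc k))) (sumFin m (λ k → g (suc k))))

sumFin-*ʳ : ∀ m (f : Fin m → ℚ) c → sumFin m (λ k → f k *ℚ c) ≡ sumFin m f *ℚ c
sumFin-*ʳ zero    f c = sym (*-zeroˡ c)
sumFin-*ʳ (suc m) f c =
  trans (cong (f zero *ℚ c +ℚ_) (sumFin-*ʳ m (λ k → f (suc k)) c))
        (solve 3 (λ a s c → a :* c :+ s :* c := (a :+ s) :* c) refl (f zero) (sumFin m (λ k → f (suc k))) c)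

sumFin-↑ : ∀ m k (f : Fin (m + k) → ℚ) →
           sumFin (m + k) f ≡ sumFin m (λ i → f (i ↑ˡ k)) +ℚ sumFin k (λ j → f (m ↑ʳ j))
sumFin-↑ zero    k f = sym (+-identityˡ _)
sumFin-↑ (suc m) k f =
  trans (cong (f zero +ℚ_) (sumFin-↑ m k (λ x → f (suc x))))
        (solve 3 (λ a b c → a :+ (b :+ c) := (a :+ b) :+ c) refl
               (f zero) (sumFin m (λ i → f (suc (i ↑ˡ k)))) (sumFin k (λ j → f (suc m ↑ʳ j))))

neg1^-square : ∀ e → neg1^ e *ℚ neg1^ e ≡ 1ℚ
neg1^-square zero    = refl
neg1^-square (suc e) = trans (solve 1 (λ x → (:- x) :* (:- x) := x :* x) refl (neg1^ e)) (neg1^-square e)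

*-neg1^-cancel : ∀ e c → c *ℚ neg1^ e ≡ 0ℚ → c ≡ 0ℚ
*-neg1^-cancel e c c*s≡0 = begin
  c                            ≡⟨ solve 1 (λ c → c := c :* con 1ℚ) refl c ⟩
  c *ℚ 1ℚ                      ≡⟨ cong (c *ℚ_) (neg1^-square e) ⟨
  c *ℚ (neg1^ e *ℚ neg1^ e)    ≡⟨ *-assoc c (neg1^ e) (neg1^ e) ⟨
  c *ℚ neg1^ e *ℚ neg1^ e      ≡⟨ cong (_*ℚ neg1^ e) c*s≡0 ⟩
  0ℚ *ℚ neg1^ e                ≡⟨ *-zeroˡ (neg1^ e) ⟩
  0ℚ                           ∎
  where open ≡-Reasoning

length-cartesianProductWith : ∀ {A B C : Set} (f : A → B → C) xs ys →
                              length (cartesianProductWith f xs ys) ≡ length xs * length ys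
length-cartesianProductWith f []        ys = refl
length-cartesianProductWith f (x ∷ˡ xs) ys =
  trans (length-++ (map (f x) ys)) (cong₂ _+_ (length-map (f x) ys) (length-cartesianProductWith f xs ys))

module _ (n : ℕ) where

  left right : Fin n → Fin (n + n)
  left i  = i ↑ˡ n
  right j = n ↑ʳ j

  v : Fin n → ℚ
  v i = neg1^ (n ∸ suc (toℕ i))

  exchange : Fin n → Fin n → Subset (n + n)
  exchange i j = (firstHalf n - left i) ∪ ⁅ right j ⁆

  rightSum : (Fin (n + n) → ℚ) → ℚ
  rightSum λc = sumFin n (λ k → λc (right k))

  Kernel : (Fin (n + n) → ℚ) → Set
  Kernel λc = ∀ i → sumFin (n + n) (λ j → λc j *ℚ entry n i j) ≡ 0ℚ

  SupportedIn : Subset (n + n) → (Fin (n + n) → ℚ) → Set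
  SupportedIn S λc = ∀ x → x ∉ S → λc x ≡ 0ℚ

  entry-left-diag : ∀ i → entry n i (left i) ≡ 1ℚ
  entry-left-diag i rewrite splitAt-↑ˡ n i n with i ≟ᶠ i
  ... | yes _  = refl
  ... | no i≢i = ⊥-elim (i≢i refl)

  entry-left-offdiag : ∀ i k → i ≢ k → entry n i (left k) ≡ 0ℚ
  entry-left-offdiag i k i≢k rewrite splitAt-↑ˡ n k n with i ≟ᶠ k
  ... | yes i≡k = ⊥-elim (i≢k i≡k)
  ... | no _    = refl

  entry-right : ∀ i k → entry n i (right k) ≡ v i
  entry-right i k rewrite splitAt-↑ʳ n n k = refl

  row-expansion : ∀ λc i → sumFin (n + n) (λ j → λc j *ℚ entry n i j) ≡ λc (left i) +ℚ rightSum λc *ℚ v i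
  row-expansion λc i = trans (sumFin-↑ n n (λ j → λc j *ℚ entry n i j)) (cong₂ _+ℚ_ leftPart rightPart)
    where
    leftPart : sumFin n (λ k → λc (left k) *ℚ entry n i (left k)) ≡ λc (left i)
    leftPart = begin
      sumFin n (λ k → λc (left k) *ℚ entry n i (left k))
        ≡⟨ sumFin-single n i (λ k k≢i → trans (cong (λc (left k) *ℚ_) (entry-left-offdiag i k (λ i≡k → k≢i (sym i≡k))))
                                               (solve 1 (λ x → x :* con 0ℚ := con 0ℚ) refl (λc (left k)))) ⟩
      λc (left i) *ℚ entry n i (left i)  ≡⟨ cong (λc (left i) *ℚ_) (entry-left-diag i) ⟩
      λc (left i) *ℚ 1ℚ                  ≡⟨ solve 1 (λ x → x :* con 1ℚ := x) refl (λc (left i)) ⟩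
      λc (left i)                        ∎
      where open ≡-Reasoning
    rightPart : sumFin n (λ k → λc (right k) *ℚ entry n i (right k)) ≡ rightSum λc *ℚ v i
    rightPart = trans (sumFin-cong n (λ k → cong (λc (right k) *ℚ_) (entry-right i k)))
                      (sumFin-*ʳ n (λ k → λc (right k)) (v i))

  kernel-row : ∀ λc → Kernel λc → ∀ i → λc (left i) +ℚ rightSum λc *ℚ v i ≡ 0ℚ
  kernel-row λc ker i = trans (sym (row-expansion λc i)) (ker i)

  extend : (Fin n → ℚ) → Fin (n + n) → ℚ
  extend g = (λ i → - (sumFin n g *ℚ v i)) Vector.++ g

  extend-left : ∀ g i → extend g (left i) ≡ - (sumFin n g *ℚ v i)
  extend-left g = ++-↑ˡ {m = n} {n = n} (λ i → - (sumFin n g *ℚ v i)) g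

  extend-right : ∀ g k → extend g (right k) ≡ g k
  extend-right g = ++-↑ʳ {m = n} {n = n} (λ i → - (sumFin n g *ℚ v i)) g

  rightSum-extend : ∀ g → rightSum (extend g) ≡ sumFin n g
  rightSum-extend g = sumFin-cong n (extend-right g)

  extend-kernel : ∀ g → Kernel (extend g)
  extend-kernel g i = begin
    sumFin (n + n) (λ j → extend g j *ℚ entry n i j)  ≡⟨ row-expansion (extend g) i ⟩
    extend g (left i) +ℚ rightSum (extend g) *ℚ v i   ≡⟨ cong₂ (λ a s → a +ℚ s *ℚ v i) (extend-left g i) (rightSum-extend g) ⟩
    - (sumFin n g *ℚ v i) +ℚ sumFin n g *ℚ v i        ≡⟨ +-inverseˡ (sumFin n g *ℚ v i) ⟩
    0ℚ                                                ∎
    where open ≡-Reasoning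

  extend-witness⇒¬linIndep : ∀ {S g j} → SupportedIn S (extend g) → g j ≢ 0ℚ → ¬ LinIndep n S
  extend-witness⇒¬linIndep {g = g} {j} supp gj≢0 ind =
    gj≢0 (trans (sym (extend-right g j)) (ind (extend g) supp (extend-kernel g) (right j)))

  δ : Fin n → Fin n → ℚ
  δ j k with j ≟ᶠ k
  ... | yes _ = 1ℚ
  ... | no _  = 0ℚ

  δ-refl : ∀ j → δ j j ≡ 1ℚ
  δ-refl j with j ≟ᶠ j
  ... | yes _  = refl
  ... | no j≢j = ⊥-elim (j≢j refl)

  δ-≢ : ∀ {j k} → j ≢ k → δ j k ≡ 0ℚ
  δ-≢ {j} {k} j≢k with j ≟ᶠ k
  ... | yes j≡k = ⊥-elim (j≢k j≡k)
  ... | no _    = refl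

  sumFin-δ : ∀ j → sumFin n (δ j) ≡ 1ℚ
  sumFin-δ j = trans (sumFin-single n j (λ k k≢j → δ-≢ (λ j≡k → k≢j (sym j≡k)))) (δ-refl j)

  right∈∧right∉⇒≢ : ∀ {S j k} → right j ∈ S → right k ∉ S → j ≢ k
  right∈∧right∉⇒≢ {S} Rj∈S Rk∉S j≡k = Rk∉S (subst (λ k → right k ∈ S) j≡k Rj∈S)

  two-right⇒¬linIndep : ∀ {S j j'} → j ≢ j' → right j ∈ S → right j' ∈ S → ¬ LinIndep n S
  two-right⇒¬linIndep {S} {j} {j'} j≢j' Rj∈S Rj'∈S = extend-witness⇒¬linIndep supp gj≢0
    where
    g : Fin n → ℚ
    g k = δ j k +ℚ δ j' k *ℚ - 1ℚ
    gj≢0 : g j ≢ 0ℚ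
    gj≢0 gj≡0 = 1≢0 (trans (sym (cong₂ (λ a b → a +ℚ b *ℚ - 1ℚ) (δ-refl j) (δ-≢ (λ j'≡j → j≢j' (sym j'≡j))))) gj≡0)
    sum-g : sumFin n g ≡ 0ℚ
    sum-g = begin
      sumFin n g                                          ≡⟨ sumFin-+ n (δ j) (λ k → δ j' k *ℚ - 1ℚ) ⟩
      sumFin n (δ j) +ℚ sumFin n (λ k → δ j' k *ℚ - 1ℚ)   ≡⟨ cong₂ _+ℚ_ (sumFin-δ j) (sumFin-*ʳ n (δ j') (- 1ℚ)) ⟩
      1ℚ +ℚ sumFin n (δ j') *ℚ - 1ℚ                       ≡⟨ cong (λ s → 1ℚ +ℚ s *ℚ - 1ℚ) (sumFin-δ j') ⟩
      0ℚ                                                  ∎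
      where open ≡-Reasoning
    supp : SupportedIn S (extend g)
    supp = ↑-elim _
      (λ i _ → trans (extend-left g i) (trans (cong (λ s → - (s *ℚ v i)) sum-g) (solve 1 (λ x → :- (con 0ℚ :* x) := con 0ℚ) refl (v i))))
      (λ k Rk∉S → trans (extend-right g k)
        (cong₂ (λ a b → a +ℚ b *ℚ - 1ℚ) (δ-≢ (right∈∧right∉⇒≢ Rj∈S Rk∉S)) (δ-≢ (right∈∧right∉⇒≢ Rj'∈S Rk∉S))))

  all-left∧right⇒¬linIndep : ∀ {S j} → (∀ i → left i ∈ S) → right j ∈ S → ¬ LinIndep n S
  all-left∧right⇒¬linIndep {S} {j} L⊆S Rj∈S = extend-witness⇒¬linIndep supp (λ δjj≡0 → 1≢0 (trans (sym (δ-refl j)) δjj≡0))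
    where
    supp : SupportedIn S (extend (δ j))
    supp = ↑-elim _ (λ i Li∉S → ⊥-elim (Li∉S (L⊆S i)))
                    (λ k Rk∉S → trans (extend-right (δ j) k) (δ-≢ (right∈∧right∉⇒≢ Rj∈S Rk∉S)))

  kernel-left≡0⇒rightSum≡0 : ∀ λc {i} → Kernel λc → λc (left i) ≡ 0ℚ → rightSum λc ≡ 0ℚ
  kernel-left≡0⇒rightSum≡0 λc {i} ker λLi≡0 = *-neg1^-cancel (n ∸ suc (toℕ i)) (rightSum λc) (begin
    rightSum λc *ℚ v i                  ≡⟨ +-identityˡ _ ⟨
    0ℚ +ℚ rightSum λc *ℚ v i            ≡⟨ cong (_+ℚ rightSum λc *ℚ v i) λLi≡0 ⟨
    λc (left i) +ℚ rightSum λc *ℚ v i   ≡⟨ kernel-row λc ker i ⟩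
    0ℚ                                  ∎)
    where open ≡-Reasoning

  kernel-rightSum≡0⇒left≡0 : ∀ λc → Kernel λc → rightSum λc ≡ 0ℚ → ∀ i → λc (left i) ≡ 0ℚ
  kernel-rightSum≡0⇒left≡0 λc ker c≡0 i = begin
    λc (left i)                         ≡⟨ solve 2 (λ a w → a := a :+ con 0ℚ :* w) refl (λc (left i)) (v i) ⟩
    λc (left i) +ℚ 0ℚ *ℚ v i            ≡⟨ cong (λ c → λc (left i) +ℚ c *ℚ v i) c≡0 ⟨
    λc (left i) +ℚ rightSum λc *ℚ v i   ≡⟨ kernel-row λc ker i ⟩
    0ℚ                                  ∎
    where open ≡-Reasoning

  AtMostOneRight : Subset (n + n) → Set
  AtMostOneRight S = ∀ {j j'} → right j ∈ S → right j' ∈ S → j ≡ j'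

  RightMissesLeft : Subset (n + n) → Set
  RightMissesLeft S = ∀ {j} → right j ∈ S → ∃[ i ] left i ∉ S

  linIndep⇒atMostOneRight : ∀ {S} → LinIndep n S → AtMostOneRight S
  linIndep⇒atMostOneRight ind {j} {j'} Rj∈S Rj'∈S with j ≟ᶠ j'
  ... | yes j≡j' = j≡j'
  ... | no j≢j'  = ⊥-elim (two-right⇒¬linIndep j≢j' Rj∈S Rj'∈S ind)

  linIndep⇒rightMissesLeft : ∀ {S} → LinIndep n S → RightMissesLeft S
  linIndep⇒rightMissesLeft {S} ind Rj∈S =
    ¬∀⟶∃¬ n (λ i → left i ∈ S) (λ i → left i ∈? S) (λ L⊆S → all-left∧right⇒¬linIndep L⊆S Rj∈S ind)

  atMostOneRight∧rightMissesLeft⇒linIndep : ∀ {S} → AtMostOneRight S → RightMissesLeft S → LinIndep n S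
  atMostOneRight∧rightMissesLeft⇒linIndep {S} one miss λc supp ker =
    ↑-elim _ (kernel-rightSum≡0⇒left≡0 λc ker (sumFin-zero n rightZero)) rightZero
    where
    rightZero : ∀ k → λc (right k) ≡ 0ℚ
    rightZero k with right k ∈? S
    ... | no Rk∉S  = supp (right k) Rk∉S
    ... | yes Rk∈S = trans (sym rightSum≡λRk) (rightSum≡0 (miss Rk∈S))
      where
      rightSum≡λRk : rightSum λc ≡ λc (right k)
      rightSum≡λRk = sumFin-single n k (λ k' k'≢k → supp (right k') (λ Rk'∈S → k'≢k (one Rk'∈S Rk∈S)))
      rightSum≡0 : ∃[ i ] left i ∉ S → rightSum λc ≡ 0ℚ
      rightSum≡0 (i , Li∉S) = kernel-left≡0⇒rightSum≡0 λc ker (supp (left i) Li∉S)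

  left∈firstHalf : ∀ i → left i ∈ firstHalf n
  left∈firstHalf i = lookup⇒[]= (left i) (firstHalf n) (trans (lookup-++ˡ ⊤ ⊥ i) (lookup-replicate i inside))

  right∉firstHalf : ∀ j → right j ∉ firstHalf n
  right∉firstHalf j Rj∈F with trans (sym ([]=⇒lookup Rj∈F)) (trans (lookup-++ʳ (⊤ {n}) ⊥ j) (lookup-replicate j outside))
  ... | ()

  left∈exchange : ∀ {i j k} → k ≢ i → left k ∈ exchange i j
  left∈exchange {i} {j} {k} k≢i =
    x∈p∪q⁺ (inj₁ (x∈p∧x≢y⇒x∈p-y (left∈firstHalf k) (λ Lk≡Li → k≢i (↑ˡ-injective n k i Lk≡Li))))

  left∉exchange : ∀ i j → left i ∉ exchange i j
  left∉exchange i j Li∈T with x∈p∪q⁻ (firstHalf n - left i) ⁅ right j ⁆ Li∈T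
  ... | inj₁ Li∈F-Li = x∉p-x Li∈F-Li
  ... | inj₂ Li∈⁅Rj⁆ = ↑ˡ≢↑ʳ i j (x∈⁅y⁆⇒x≡y (right j) Li∈⁅Rj⁆)

  right∈exchange : ∀ i j → right j ∈ exchange i j
  right∈exchange i j = x∈p∪q⁺ (inj₂ (x∈⁅x⁆ (right j)))

  right∈exchange⇒≡ : ∀ {i j k} → right k ∈ exchange i j → k ≡ j
  right∈exchange⇒≡ {i} {j} {k} Rk∈T with x∈p∪q⁻ (firstHalf n - left i) ⁅ right j ⁆ Rk∈T
  ... | inj₁ Rk∈F-Li = ⊥-elim (right∉firstHalf k (p─q⊆p (firstHalf n) ⁅ left i ⁆ Rk∈F-Li))
  ... | inj₂ Rk∈⁅Rj⁆ = ↑ʳ-injective n k j (x∈⁅y⁆⇒x≡y (right j) Rk∈⁅Rj⁆)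

  maximal⇒isBasis : ∀ {B} → LinIndep n B → (∀ S → B ⊆ S → LinIndep n S → S ⊆ B) → IsBasis n B
  maximal⇒isBasis ind max = ind , λ S B⊆S indS → ⊆-antisym (max S B⊆S indS) B⊆S

  firstHalf-linIndep : LinIndep n (firstHalf n)
  firstHalf-linIndep = atMostOneRight∧rightMissesLeft⇒linIndep
    (λ Rj∈F _ → ⊥-elim (right∉firstHalf _ Rj∈F))
    (λ Rj∈F → ⊥-elim (right∉firstHalf _ Rj∈F))

  exchange-linIndep : ∀ i j → LinIndep n (exchange i j)
  exchange-linIndep i j = atMostOneRight∧rightMissesLeft⇒linIndep
    (λ Rk∈T Rk'∈T → trans (right∈exchange⇒≡ Rk∈T) (sym (right∈exchange⇒≡ Rk'∈T)))
    (λ _ → i , left∉exchange i j)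

  firstHalf-isBasis : IsBasis n (firstHalf n)
  firstHalf-isBasis = maximal⇒isBasis firstHalf-linIndep λ S F⊆S indS →
    ⊆-↑ (λ i _ → left∈firstHalf i)
        (λ j Rj∈S → let (i , Li∉S) = linIndep⇒rightMissesLeft indS Rj∈S in ⊥-elim (Li∉S (F⊆S (left∈firstHalf i))))

  ⊆-exchange : ∀ {S i j} → left i ∉ S → (∀ {k} → right k ∈ S → k ≡ j) → S ⊆ exchange i j
  ⊆-exchange {S} {i} {j} Li∉S onlyRj = ⊆-↑ leftCase rightCase
    where
    leftCase : ∀ k → left k ∈ S → left k ∈ exchange i j
    leftCase k Lk∈S = left∈exchange (λ k≡i → Li∉S (subst (λ k → left k ∈ S) k≡i Lk∈S))
    rightCase : ∀ k → right k ∈ S → right k ∈ exchange i j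
    rightCase k Rk∈S = subst (λ k → right k ∈ exchange i j) (sym (onlyRj Rk∈S)) (right∈exchange i j)

  exchange⊆⇒left∉ : ∀ {S i j} → exchange i j ⊆ S → LinIndep n S → left i ∉ S
  exchange⊆⇒left∉ {S} {i} {j} T⊆S indS Li∈S = missing (linIndep⇒rightMissesLeft indS (T⊆S (right∈exchange i j)))
    where
    missing : ¬ (∃[ i' ] left i' ∉ S)
    missing (i' , Li'∉S) with i' ≟ᶠ i
    ... | yes refl = Li'∉S Li∈S
    ... | no i'≢i  = Li'∉S (T⊆S (left∈exchange i'≢i))

  exchange-isBasis : ∀ i j → IsBasis n (exchange i j)
  exchange-isBasis i j = maximal⇒isBasis (exchange-linIndep i j) λ S T⊆S indS →
    ⊆-exchange (exchange⊆⇒left∉ T⊆S indS) (λ Rk∈S → linIndep⇒atMostOneRight indS Rk∈S (T⊆S (right∈exchange i j)))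

  isBasis⇒firstHalf⊎exchange : ∀ B → IsBasis n B → B ≡ firstHalf n ⊎ ∃[ i ] ∃[ j ] B ≡ exchange i j
  isBasis⇒firstHalf⊎exchange B (indB , maxB) with any? (λ j → right j ∈? B)
  ... | no noRight = inj₁ (sym (maxB (firstHalf n) B⊆F firstHalf-linIndep))
    where
    B⊆F : B ⊆ firstHalf n
    B⊆F = ⊆-↑ (λ i _ → left∈firstHalf i) (λ j Rj∈B → ⊥-elim (noRight (j , Rj∈B)))
  ... | yes (j , Rj∈B) = inj₂ (exchangeAt (linIndep⇒rightMissesLeft indB Rj∈B))
    where
    exchangeAt : ∃[ i ] left i ∉ B → ∃[ i ] ∃[ j ] B ≡ exchange i j
    exchangeAt (i , Li∉B) = i , j , sym (maxB (exchange i j) B⊆T (exchange-linIndep i j))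
      where
      B⊆T : B ⊆ exchange i j
      B⊆T = ⊆-exchange Li∉B (λ Rk∈B → linIndep⇒atMostOneRight indB Rk∈B Rj∈B)

  exchange-injective : ∀ {i j i' j'} → exchange i j ≡ exchange i' j' → i ≡ i' × j ≡ j'
  exchange-injective {i} {j} {i'} {j'} T≡T' = i≡i' , right∈exchange⇒≡ (subst (right j ∈_) T≡T' (right∈exchange i j))
    where
    i≡i' : i ≡ i'
    i≡i' with i ≟ᶠ i'
    ... | yes i≡i' = i≡i'
    ... | no i≢i'  = ⊥-elim (left∉exchange i' j' (subst (left i' ∈_) T≡T' (left∈exchange (λ i'≡i → i≢i' (sym i'≡i)))))

  firstHalf≢exchange : ∀ i j → firstHalf n ≢ exchange i j
  firstHalf≢exchange i j F≡T = left∉exchange i j (subst (left i ∈_) F≡T (left∈firstHalf i))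

  exchanges : List (Subset (n + n))
  exchanges = cartesianProductWith exchange (allFin n) (allFin n)

  bases : List (Subset (n + n))
  bases = firstHalf n ∷ˡ exchanges

  bases-unique : Unique bases
  bases-unique = ¬Any⇒All¬ exchanges firstHalf∉exchanges ∷ cartesianProductWith⁺ exchange exchange-injective (allFin⁺ n) (allFin⁺ n)
    where
    firstHalf∉exchanges : ¬ (firstHalf n ∈ˡ exchanges)
    firstHalf∉exchanges F∈Ts with ∈-cartesianProductWith⁻ exchange (allFin n) (allFin n) F∈Ts
    ... | i , j , _ , _ , F≡T = firstHalf≢exchange i j F≡T

  isBasis⇔∈bases : ∀ B → IsBasis n B ⇔ B ∈ˡ bases
  isBasis⇔∈bases B = mk⇔ to from
    where
    to : IsBasis n B → B ∈ˡ bases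
    to isB with isBasis⇒firstHalf⊎exchange B isB
    ... | inj₁ B≡F           = here B≡F
    ... | inj₂ (i , j , B≡T) = there (subst (_∈ˡ exchanges) (sym B≡T) (∈-cartesianProductWith⁺ exchange (∈-allFin i) (∈-allFin j)))
    from : B ∈ˡ bases → IsBasis n B
    from (here B≡F) = subst (IsBasis n) (sym B≡F) firstHalf-isBasis
    from (there B∈Ts) with ∈-cartesianProductWith⁻ exchange (allFin n) (allFin n) B∈Ts
    ... | i , j , _ , _ , B≡T = subst (IsBasis n) (sym B≡T) (exchange-isBasis i j)

  length-bases : length bases ≡ n * n + 1
  length-bases = begin
    suc (length exchanges)                        ≡⟨ cong suc (length-cartesianProductWith exchange (allFin n) (allFin n)) ⟩
    suc (length (allFin n) * length (allFin n))   ≡⟨ cong suc (cong₂ _*_ length-allFin length-allFin) ⟩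
    suc (n * n)                                   ≡⟨ ℕ.+-comm 1 (n * n) ⟩
    n * n + 1                                     ∎
    where
    open ≡-Reasoning
    length-allFin : length (allFin n) ≡ n
    length-allFin = length-tabulate (λ i → i)

lemma4p1 : (n : ℕ) → 1 ≤ n →
    ((B : Subset (n + n)) → IsBasis n B →
      (B ≡ firstHalf n)
      ⊎ (∃[ i ] ∃[ j ] B ≡ ((firstHalf n - (i ↑ˡ n)) ∪ ⁅ n ↑ʳ j ⁆)))
    × (∃[ bs ] (Unique bs × ((B : Subset (n + n)) → (IsBasis n B ⇔ B ∈ˡ bs)) × length bs ≡ n * n + 1))
lemma4p1 n _ = isBasis⇒firstHalf⊎exchange n , bases n , bases-unique n , isBasis⇔∈bases n , length-bases n
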